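{- There is an absolute constant $C>0$ such that for all integers $n > k \geq 1$, $\mathrm{rank}_{\mathbb{B}}(D_{n,k}) \leq C\, k\log n$.
   Context: $D_{n,k}$ is the $n\times n$ circulant $0,1$ matrix whose first row consists of $n-k$ consecutive ones followed by $k$ zeros, each subsequent row being the cyclic shift of the previous row by one position to the right. The Boolean rank $\mathrm{rank}_{\mathbb{B}}(M)$ of a $0,1$ matrix $M$ is the minimal $r$ such that $M=A\cdot B$ for $0,1$ matrices $A,B$ of inner dimension $r$ with Boolean arithmetic ($1+1=1$); equivalently, the minimum number of all-ones submatrices covering all $1$-entries of $M$. -}

module Defs where

open import Data.Nat using (ℕ; zero; suc; _+_; _∸_; _<ᵇ_)
open import Data.Nat.DivMod using (_%_)
open import Data.Bool using (Bool; true; false; _∧_; _∨_)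
open import Data.Fin using (Fin; toℕ)
open import Data.Product using (Σ)
open import Relation.Binary.PropositionalEquality using (_≡_)

BMatrix : ℕ → ℕ → Set
BMatrix m n = Fin m → Fin n → Bool

bigOr : (r : ℕ) → (Fin r → Bool) → Bool
bigOr zero    f = false
bigOr (suc r) f = f Fin.zero ∨ bigOr r (λ l → f (Fin.suc l))

_⊙_ : ∀ {m r n} → BMatrix m r → BMatrix r n → BMatrix m n
_⊙_ {r = r} A B i j = bigOr r (λ l → A i l ∧ B l j)

-- M has a Boolean factorization of inner dimension r, i.e. rank_B(M) ≤ r
-- (rank_B(M) is the least such r).
HasBoolFactorization : ∀ {m n} → BMatrix m n → ℕ → Set
HasBoolFactorization {m} {n} M r =
  Σ (BMatrix m r) λ A → Σ (BMatrix r n) λ B → ∀ i j → M i j ≡ (A ⊙ B) i j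

-- D_{n,k}: entry (i,j) (0-indexed) is 1 iff (j - i) mod n < n - k.
-- Row 0 is n-k ones then k zeros; row i is row 0 cyclically shifted right by i.
D : (n k : ℕ) → BMatrix n n
D (suc m) k i j = ((toℕ j + (suc m ∸ toℕ i)) % suc m) <ᵇ (suc m ∸ k)

-- Column j of D n k has its zeros exactly in the cyclic window j+1, …, j+k (mod n). When 2k ≤ n,
-- moving the points below a threshold (0 or k) up by n turns each window into an ordinary interval
-- of length k, and for a suitable shift t < k that interval is one block of the partition of ℕ into
-- blocks of length k. A row i outside the window lies in another block, so the two block indices
-- differ in one of their ⌈log₂ n⌉ + 1 bits, and the rows agreeing with i in that bit form a
-- rectangle of ones through (i, j). This covers the ones of D n k by 4k(⌈log₂ n⌉ + 1) rectangles;
-- when 2k > n the n single rows already suffice.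
module Submission where

open import Defs
open import Data.Bool using (Bool; true; false; T; _∧_; _∨_; if_then_else_)
open import Data.Bool.Properties using (⇔→≡; ∨-zeroʳ; ¬-not)
import Data.Bool.Properties as Bool
open import Data.Fin using (Fin; zero; suc; toℕ; fromℕ<; _≟_)
open import Data.Fin.Properties using (all?; *↔×; toℕ<n; toℕ-fromℕ<)
open import Data.Nat
  using ( ℕ; zero; suc; _+_; _*_; _∸_; _^_; _≤_; _<_; _<ᵇ_; _≤?_; z≤n; s≤s; s≤s⁻¹
        ; NonZero; >-nonZero⁻¹; ⌈_/2⌉)
open import Data.Nat.DivMod
open import Data.Nat.Induction using (<-wellFounded)
open import Data.Nat.Logarithm using (⌈log₂_⌉; ⌈log₂⌉-mono-≤)
open import Data.Nat.Logarithm.Core using (⌈log2⌉)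
open import Data.Nat.Properties hiding (_≟_)
open import Data.Nat.Tactic.RingSolver using (solve-∀)
open import Data.Product using (Σ; ∃-syntax; _×_; _,_; proj₁; proj₂)
open import Data.Product.Function.NonDependent.Propositional using (_×-↠_)
open import Data.Sum using (_⊎_; inj₁; inj₂)
open import Data.Unit using (tt)
open import Function using (_∘_; _⇔_; mk⇔; Equivalence; _↠_; Surjection)
open import Function.Construct.Composition using (_↠-∘_; _⇔-∘_)
open import Function.Construct.Identity using (↠-id)
open import Function.Construct.Symmetry using (⇔-sym)
open import Function.Properties.Inverse using (↔⇒↠)
open import Induction.WellFounded using (Acc; acc)
open import Relation.Nullary using (Dec; yes; no; does; _→-dec_; contradiction)
open import Relation.Nullary.Decidable using (dec-true)
open import Relation.Binary.PropositionalEquality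
  using (_≡_; _≢_; refl; sym; trans; cong; cong₂; subst; subst₂; module ≡-Reasoning)

open Equivalence using (to; from)

bigOr-intro : ∀ {r} (f : Fin r → Bool) l → f l ≡ true → bigOr r f ≡ true
bigOr-intro f zero    fl≡true = cong (_∨ bigOr _ (f ∘ suc)) fl≡true
bigOr-intro f (suc l) fl≡true =
  trans (cong (f zero ∨_) (bigOr-intro (f ∘ suc) l fl≡true)) (∨-zeroʳ (f zero))

bigOr-elim : ∀ r (f : Fin r → Bool) → bigOr r f ≡ true → ∃[ l ] f l ≡ true
bigOr-elim (suc r) f or≡true with f zero in f0≡b
... | true  = zero , f0≡b
... | false = let l , fl≡true = bigOr-elim r (f ∘ suc) or≡true in suc l , fl≡true

∧≡true⇒ : ∀ {a b} → a ∧ b ≡ true → a ≡ true × b ≡ true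
∧≡true⇒ {true} {true} _ = refl , refl

does≡true⇒ : ∀ {A : Set} (a? : Dec A) → does a? ≡ true → A
does≡true⇒ (yes a) _ = a

Covers : ∀ {m n} {Ix : Set} → BMatrix m n → (Ix → Fin m → Set) → Set
Covers M R = ∀ i j → M i j ≡ true → ∃[ x ] R x i × (∀ i′ → R x i′ → M i′ j ≡ true)

cover⇒factorization : ∀ {m n r} {Ix : Set} (M : BMatrix m n) {R : Ix → Fin m → Set} →
  (∀ x i → Dec (R x i)) → Fin r ↠ Ix → Covers M R → HasBoolFactorization M r
cover⇒factorization {m} {n} {r} M {R} R? enum cover =
  A , B , λ i j → ⇔→≡ (mk⇔ (M⇒A⊙B i j) (A⊙B⇒M i j))
  where
  open Surjection enum using (to⁻; to∘to⁻) renaming (to to index)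

  A : BMatrix m r
  A i l = does (R? (index l) i)

  B : BMatrix r n
  B l j = does (all? λ i → R? (index l) i →-dec (M i j Bool.≟ true))

  M⇒A⊙B : ∀ i j → M i j ≡ true → (A ⊙ B) i j ≡ true
  M⇒A⊙B i j Mij≡true with cover i j Mij≡true
  ... | x , Rxi , Rx⊆Mj = bigOr-intro (λ l → A i l ∧ B l j) l (cong₂ _∧_ Ail≡true Blj≡true)
    where
    l : Fin r
    l = to⁻ x
    Ail≡true : A i l ≡ true
    Ail≡true = dec-true (R? (index l) i) (subst (λ y → R y i) (sym (to∘to⁻ x)) Rxi)
    Blj≡true : B l j ≡ true
    Blj≡true = dec-true (all? _) (λ i′ → Rx⊆Mj i′ ∘ subst (λ y → R y i′) (to∘to⁻ x))

  A⊙B⇒M : ∀ i j → (A ⊙ B) i j ≡ true → M i j ≡ true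
  A⊙B⇒M i j A⊙B≡true with bigOr-elim r _ A⊙B≡true
  ... | l , AB≡true with ∧≡true⇒ {A i l} AB≡true
  ... | Ail≡true , Blj≡true =
    does≡true⇒ (all? _) Blj≡true i (does≡true⇒ (R? (index l) i) Ail≡true)

HasBoolFactorization-byRows : ∀ {m n} (M : BMatrix m n) → HasBoolFactorization M m
HasBoolFactorization-byRows M =
  cover⇒factorization M (λ l i → l ≟ i) (↠-id _)
    (λ i j Mij≡true → i , refl , λ { _ refl → Mij≡true })

Fin*↠× : ∀ {a b} {A B : Set} → Fin a ↠ A → Fin b ↠ B → Fin (a * b) ↠ (A × B)
Fin*↠× f g = (f ×-↠ g) ↠-∘ ↔⇒↠ *↔×

infix 4 _∈[_,_⟩
_∈[_,_⟩ : ℕ → ℕ → ℕ → Set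
y ∈[ a , b ⟩ = a ≤ y × y < b

∈[+,+⟩⇔ : ∀ {y a b} s → y + s ∈[ a + s , b + s ⟩ ⇔ y ∈[ a , b ⟩
∈[+,+⟩⇔ {y} {a} {b} s = mk⇔
  (λ (a+s≤y+s , y+s<b+s) → +-cancelʳ-≤ s a y a+s≤y+s , +-cancelʳ-< s y b y+s<b+s)
  (λ (a≤y , y<b) → +-monoˡ-≤ s a≤y , +-monoˡ-< s y<b)

m/n≡q⇔ : ∀ {m n q} .{{_ : NonZero n}} → m / n ≡ q ⇔ m ∈[ q * n , suc q * n ⟩
m/n≡q⇔ {m} {n} {q} = mk⇔
  (λ { refl → m/n*n≤m m n , m<[1+m/n]*n })
  (λ (qn≤m , m<[1+q]n) → ≤-antisym (s≤s⁻¹ (m<n*o⇒m/o<n m<[1+q]n))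
                                   (subst (_≤ m / n) (m*n/n≡m q n) (/-monoˡ-≤ n qn≤m)))
  where
  m<[1+m/n]*n : m < suc (m / n) * n
  m<[1+m/n]*n = subst (_< n + m / n * n) (sym (m≡m%n+[m/n]*n m n)) (+-monoˡ-< (m / n * n) (m%n<n m n))

<ᵇ≡false⇔ : ∀ {x y} → (x <ᵇ y) ≡ false ⇔ y ≤ x
<ᵇ≡false⇔ {x} {y} = mk⇔
  (λ x<ᵇy≡false → ≮⇒≥ λ x<y → subst T x<ᵇy≡false (<⇒<ᵇ x<y))
  (λ y≤x → ¬-not λ x<ᵇy≡true → <⇒≱ (<ᵇ⇒< x y (subst T (sym x<ᵇy≡true) tt)) y≤x)

∸≤⇔≤+ : ∀ {n k v} → k ≤ n → n ∸ k ≤ v ⇔ n ≤ v + k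
∸≤⇔≤+ {n} {k} {v} k≤n = mk⇔
  (λ n∸k≤v → subst (_≤ v + k) (m∸n+n≡m k≤n) (+-monoˡ-≤ k n∸k≤v))
  (λ n≤v+k → m≤n+o⇒m∸n≤o n k (subst (n ≤_) (+-comm v k) n≤v+k))

≤-+-exchange : ∀ {a b c d} k → a + b ≡ c + d → b ≤ c + k ⇔ d ≤ a + k
≤-+-exchange k a+b≡c+d = mk⇔ (shift a+b≡c+d) (shift (sym a+b≡c+d))
  where
  shift : ∀ {a b c d} → a + b ≡ c + d → b ≤ c + k → d ≤ a + k
  shift {a} {b} {c} {d} a+b≡c+d b≤c+k = +-cancelˡ-≤ c d (a + k) (begin
    c + d        ≡⟨ a+b≡c+d ⟨
    a + b        ≤⟨ +-monoʳ-≤ a b≤c+k ⟩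
    a + (c + k)  ≡⟨ swap a c k ⟩
    c + (a + k)  ∎)
    where
    open ≤-Reasoning
    swap : ∀ a c k → a + (c + k) ≡ c + (a + k)
    swap = solve-∀

n≤2*⌈n/2⌉ : ∀ n → n ≤ 2 * ⌈ n /2⌉
n≤2*⌈n/2⌉ 0             = z≤n
n≤2*⌈n/2⌉ 1             = s≤s z≤n
n≤2*⌈n/2⌉ (suc (suc n)) =
  subst (suc (suc n) ≤_) (sym (*-suc 2 ⌈ n /2⌉)) (s≤s (s≤s (n≤2*⌈n/2⌉ n)))

n≤2^⌈log₂n⌉ : ∀ n → n ≤ 2 ^ ⌈log₂ n ⌉
n≤2^⌈log₂n⌉ n = go n (<-wellFounded n)
  where
  go : ∀ n (rec : Acc _<_ n) → n ≤ 2 ^ ⌈log2⌉ n rec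
  go 0             _        = z≤n
  go 1             _        = s≤s z≤n
  go (suc (suc n)) (acc rs) =
    ≤-trans (n≤2*⌈n/2⌉ (suc (suc n))) (*-monoʳ-≤ 2 (go (suc ⌈ n /2⌉) _))

bit : ℕ → ℕ → Fin 2
bit zero    x = x mod 2
bit (suc b) x = bit b (x / 2)

mod-/-injective : ∀ {d} .{{_ : NonZero d}} {x y} → x mod d ≡ y mod d → x / d ≡ y / d → x ≡ y
mod-/-injective {d} {x} {y} x%≡y% x/≡y/ = begin
  x                          ≡⟨ DivMod.property (x divMod d) ⟩
  toℕ (x mod d) + x / d * d  ≡⟨ cong₂ (λ r q → toℕ r + q * d) x%≡y% x/≡y/ ⟩
  toℕ (y mod d) + y / d * d  ≡⟨ DivMod.property (y divMod d) ⟨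
  y                          ∎
  where open ≡-Reasoning

bits-differ : ∀ L {x y} → x < 2 ^ L → y < 2 ^ L → x ≢ y →
  ∃[ b ] bit (toℕ {L} b) x ≢ bit (toℕ b) y
bits-differ zero    (s≤s z≤n) (s≤s z≤n) x≢y = contradiction refl x≢y
bits-differ (suc L) {x} {y} x<2^1+L y<2^1+L x≢y with x mod 2 ≟ y mod 2
... | no  x%≢y% = zero , x%≢y%
... | yes x%≡y% =
  let b , bit≢ = bits-differ L (halve x<2^1+L) (halve y<2^1+L) (x≢y ∘ mod-/-injective x%≡y%)
  in suc b , bit≢
  where
  halve : ∀ {z} → z < 2 ^ suc L → z / 2 < 2 ^ L
  halve {z} z<2^1+L = m<n*o⇒m/o<n (subst (z <_) (*-comm 2 (2 ^ L)) z<2^1+L)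

lift : ℕ → ℕ → ℕ → ℕ
lift n c x = if x <ᵇ c then x + n else x

lift-cases : ∀ n c x → (x < c × lift n c x ≡ x + n) ⊎ (c ≤ x × lift n c x ≡ x)
lift-cases n c x with x <ᵇ c in x<ᵇc
... | true  = inj₁ (<ᵇ⇒< x c (subst T (sym x<ᵇc) tt) , refl)
... | false = inj₂ (to <ᵇ≡false⇔ x<ᵇc , refl)

lift-∈⇔ : ∀ {n c a k x} → c ≤ a → a + k ≤ n + c →
  lift n c x ∈[ a , a + k ⟩ ⇔ (x ∈[ a , a + k ⟩ ⊎ x + n ∈[ a , a + k ⟩)
lift-∈⇔ {n} {c} {a} {k} {x} c≤a a+k≤n+c with lift-cases n c x
... | inj₁ (x<c , lift≡x+n) rewrite lift≡x+n = mk⇔ inj₂ λ where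
  (inj₁ (a≤x , _)) → contradiction (≤-trans c≤a a≤x) (<⇒≱ x<c)
  (inj₂ x+n∈)      → x+n∈
... | inj₂ (c≤x , lift≡x) rewrite lift≡x = mk⇔ inj₁ λ where
  (inj₁ x∈)            → x∈
  (inj₂ (_ , x+n<a+k)) →
    contradiction (≤-trans (<-≤-trans x+n<a+k a+k≤n+c) (≤-reflexive (+-comm n c)))
                  (≤⇒≯ (+-monoˡ-≤ n c≤x))

lift<n+c : ∀ {n} c {x} → x < n → lift n c x < n + c
lift<n+c {n} c {x} x<n with lift-cases n c x
... | inj₁ (x<c , lift≡x+n) =
  subst (_< n + c) (sym (trans lift≡x+n (+-comm x n))) (+-monoʳ-< n x<c)
... | inj₂ (_ , lift≡x)     = subst (_< n + c) (sym lift≡x) (≤-trans x<n (m≤m+n n c))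

-- (J + (n ∸ I)) % n is the quantity that D compares with n ∸ k; lift n (suc J) I is the
-- representative of I in (J, J + n].
offset+lift≡ : ∀ {n} .{{_ : NonZero n}} {I J} → I < n → J < n →
  (J + (n ∸ I)) % n + lift n (suc J) I ≡ J + n
offset+lift≡ {n} {I} {J} I<n J<n with lift-cases n (suc J) I
... | inj₁ (I<1+J , lift≡I+n) = begin
  (J + (n ∸ I)) % n + lift n (suc J) I  ≡⟨ cong₂ _+_ offset≡J∸I lift≡I+n ⟩
  J ∸ I + (I + n)                       ≡⟨ +-assoc (J ∸ I) I n ⟨
  J ∸ I + I + n                         ≡⟨ cong (_+ n) (m∸n+n≡m I≤J) ⟩
  J + n                                 ∎
  where
  open ≡-Reasoning
  I≤J : I ≤ J
  I≤J = s≤s⁻¹ I<1+J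
  offset≡J∸I : (J + (n ∸ I)) % n ≡ J ∸ I
  offset≡J∸I = begin
    (J + (n ∸ I)) % n  ≡⟨ cong (_% n) J∸I+n≡J+[n∸I] ⟨
    (J ∸ I + n) % n    ≡⟨ [m+n]%n≡m%n (J ∸ I) n ⟩
    (J ∸ I) % n        ≡⟨ m<n⇒m%n≡m (≤-<-trans (m∸n≤m J I) J<n) ⟩
    J ∸ I              ∎
    where
    J∸I+n≡J+[n∸I] : J ∸ I + n ≡ J + (n ∸ I)
    J∸I+n≡J+[n∸I] = trans (sym (+-∸-comm n I≤J)) (+-∸-assoc J (<⇒≤ I<n))
... | inj₂ (J<I , lift≡I) = begin
  (J + (n ∸ I)) % n + lift n (suc J) I  ≡⟨ cong₂ _+_ (m<n⇒m%n≡m offset<n) lift≡I ⟩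
  J + (n ∸ I) + I                       ≡⟨ +-assoc J (n ∸ I) I ⟩
  J + (n ∸ I + I)                       ≡⟨ cong (J +_) (m∸n+n≡m (<⇒≤ I<n)) ⟩
  J + n                                 ∎
  where
  open ≡-Reasoning
  offset<n : J + (n ∸ I) < n
  offset<n = subst (J + (n ∸ I) <_) (m+[n∸m]≡n (<⇒≤ I<n)) (+-monoˡ-< (n ∸ I) J<I)

D≡false⇔ : ∀ {m k} → k ≤ suc m → (i j : Fin (suc m)) →
  D (suc m) k i j ≡ false ⇔
  lift (suc m) (suc (toℕ j)) (toℕ i) ∈[ suc (toℕ j) , suc (toℕ j) + k ⟩
D≡false⇔ {m} {k} k≤n i j = mk⇔
  (λ Dij≡false →
    J<lift , s≤s (from exchange (to (∸≤⇔≤+ k≤n) (to <ᵇ≡false⇔ Dij≡false))))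
  (λ (_ , lift<1+J+k) →
    from <ᵇ≡false⇔ (from (∸≤⇔≤+ k≤n) (to exchange (s≤s⁻¹ lift<1+J+k))))
  where
  n I J : ℕ
  n = suc m
  I = toℕ i
  J = toℕ j
  exchange : lift n (suc J) I ≤ J + k ⇔ n ≤ (J + (n ∸ I)) % n + k
  exchange = ≤-+-exchange k (offset+lift≡ (toℕ<n i) (toℕ<n j))
  J<lift : J < lift n (suc J) I
  J<lift with lift-cases n (suc J) I
  ... | inj₁ (_ , lift≡I+n) = subst (J <_) (sym lift≡I+n) (≤-trans (toℕ<n j) (m≤n+m n I))
  ... | inj₂ (J<I , lift≡I) = subst (J <_) (sym lift≡I) J<I

block : (K : ℕ) .{{_ : NonZero K}} → Fin K → ℕ → ℕ
block K t y = (y + suc (toℕ t)) / K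

alignment : ∀ K .{{_ : NonZero K}} a → ∃[ t ] ∃[ c ] a + suc (toℕ {K} t) ≡ c * K
alignment K@(suc K-1) a = fromℕ< t<K , suc (a / K) , (begin
  a + suc (toℕ (fromℕ< t<K))  ≡⟨ cong (λ t → a + suc t) (toℕ-fromℕ< t<K) ⟩
  a + suc t                   ≡⟨ cong (_+ suc t) (m≡m%n+[m/n]*n a K) ⟩
  r + a / K * K + suc t       ≡⟨ reorder r (a / K * K) t ⟩
  suc (r + t) + a / K * K     ≡⟨ cong (λ x → suc x + a / K * K) (m+[n∸m]≡n r≤K-1) ⟩
  K + a / K * K               ∎)
  where
  open ≡-Reasoning
  r t : ℕ
  r = a % K
  t = K-1 ∸ r
  r≤K-1 : r ≤ K-1
  r≤K-1 = s≤s⁻¹ (m%n<n a K)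
  t<K : t < K
  t<K = s≤s (m∸n≤m K-1 r)
  reorder : ∀ r x t → r + x + suc t ≡ suc (r + t) + x
  reorder = solve-∀

block≡⇔ : ∀ {K} .{{_ : NonZero K}} {a t c y} → a + suc (toℕ t) ≡ c * K →
  block K t y ≡ c ⇔ y ∈[ a , a + K ⟩
block≡⇔ {K} {a} {t} {c} {y} a+s≡cK =
  ∈[+,+⟩⇔ s ⇔-∘
    subst₂ (λ lo hi → block K t y ≡ c ⇔ y + s ∈[ lo , hi ⟩) (sym a+s≡cK) [1+c]K≡a+K+s
      m/n≡q⇔
  where
  s : ℕ
  s = suc (toℕ t)
  [1+c]K≡a+K+s : suc c * K ≡ a + K + s
  [1+c]K≡a+K+s = begin
    K + c * K    ≡⟨ cong (K +_) a+s≡cK ⟨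
    K + (a + s)  ≡⟨ +-assoc K a s ⟨
    K + a + s    ≡⟨ cong (_+ s) (+-comm K a) ⟩
    a + K + s    ∎
    where open ≡-Reasoning

module _ {m K L : ℕ} .{{_ : NonZero K}} (K+K≤n : K + K ≤ suc m) (n≤2^L : suc m ≤ 2 ^ L) where

  private
    n : ℕ
    n = suc m

  threshold : Fin 2 → ℕ
  threshold zero       = 0
  threshold (suc zero) = K

  threshold≤K : ∀ ρ → threshold ρ ≤ K
  threshold≤K zero       = z≤n
  threshold≤K (suc zero) = ≤-refl

  valid-threshold : ∀ {a} → a ≤ n → ∃[ ρ ] threshold ρ ≤ a × a + K ≤ n + threshold ρ
  valid-threshold {a} a≤n with a + K ≤? n
  ... | yes a+K≤n = zero , z≤n , subst (a + K ≤_) (sym (+-identityʳ n)) a+K≤n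
  ... | no  a+K≰n = suc zero , K≤a , +-monoˡ-≤ K a≤n
    where
    K≤a : K ≤ a
    K≤a = ≮⇒≥ λ a<K → a+K≰n (≤-trans (<⇒≤ (+-monoˡ-< K a<K)) K+K≤n)

  blockIndex : Fin 2 → Fin K → ℕ → ℕ
  blockIndex ρ t x = block K t (lift n (threshold ρ) x)

  n+n≤2^[1+L] : n + n ≤ 2 ^ suc L
  n+n≤2^[1+L] =
    subst (n + n ≤_) (cong (2 ^ L +_) (sym (+-identityʳ (2 ^ L)))) (+-mono-≤ n≤2^L n≤2^L)

  blockIndex<2^[1+L] : ∀ ρ t {x} → x < n → blockIndex ρ t x < 2 ^ suc L
  blockIndex<2^[1+L] ρ t {x} x<n = begin-strict
    blockIndex ρ t x                      ≤⟨ m/n≤m _ K ⟩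
    lift n (threshold ρ) x + suc (toℕ t)  <⟨ +-mono-<-≤ (lift<n+c (threshold ρ) x<n) (toℕ<n t) ⟩
    n + threshold ρ + K                   ≤⟨ +-monoˡ-≤ K (+-monoʳ-≤ n (threshold≤K ρ)) ⟩
    n + K + K                             ≡⟨ +-assoc n K K ⟩
    n + (K + K)                           ≤⟨ +-monoʳ-≤ n K+K≤n ⟩
    n + n                                 ≤⟨ n+n≤2^[1+L] ⟩
    2 ^ suc L                             ∎
    where open ≤-Reasoning

  column-zeros : ∀ j → ∃[ ρ ] ∃[ t ] ∃[ c ]
    c < 2 ^ suc L × (∀ i → D n K i j ≡ false ⇔ blockIndex ρ t (toℕ i) ≡ c)
  column-zeros j with valid-threshold {suc (toℕ j)} (toℕ<n j) | alignment K (suc (toℕ j))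
  ... | ρ , c≤a , a+K≤n+c | t , c , a+s≡cK = ρ , t , c , c<2^[1+L] , zeros⇔
    where
    K<n : K < n
    K<n = <-≤-trans (m<m+n K (>-nonZero⁻¹ K)) K+K≤n
    a+K≤n+a : suc (toℕ j) + K ≤ n + suc (toℕ j)
    a+K≤n+a = subst (suc (toℕ j) + K ≤_) (+-comm (suc (toℕ j)) n)
                (+-monoʳ-≤ (suc (toℕ j)) (<⇒≤ K<n))
    zeros⇔ : ∀ i → D n K i j ≡ false ⇔ blockIndex ρ t (toℕ i) ≡ c
    zeros⇔ i =
      ⇔-sym (block≡⇔ a+s≡cK) ⇔-∘ (⇔-sym (lift-∈⇔ c≤a a+K≤n+c) ⇔-∘
        (lift-∈⇔ ≤-refl a+K≤n+a ⇔-∘ D≡false⇔ (<⇒≤ K<n) i j))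
    c<2^[1+L] : c < 2 ^ suc L
    c<2^[1+L] = begin-strict
      c                          ≤⟨ m≤m*n c K ⟩
      c * K                      ≡⟨ a+s≡cK ⟨
      suc (toℕ j) + suc (toℕ t)  ≤⟨ +-mono-≤ (toℕ<n j) (toℕ<n t) ⟩
      n + K                      <⟨ +-monoʳ-< n K<n ⟩
      n + n                      ≤⟨ n+n≤2^[1+L] ⟩
      2 ^ suc L                  ∎
      where open ≤-Reasoning

  BitClass : Fin 2 × Fin K × Fin (suc L) × Fin 2 → Fin n → Set
  BitClass (ρ , t , b , v) i = bit (toℕ b) (blockIndex ρ t (toℕ i)) ≡ v

  BitClass? : ∀ x i → Dec (BitClass x i)
  BitClass? (ρ , t , b , v) i = bit (toℕ b) (blockIndex ρ t (toℕ i)) ≟ v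

  D-covered : Covers (D n K) BitClass
  D-covered i j Dij≡true with column-zeros j
  ... | ρ , t , c , c<2^[1+L] , zeros⇔ = (ρ , t , b , bit (toℕ b) (β i)) , refl , bitClass⊆ones
    where
    β : Fin n → ℕ
    β i′ = blockIndex ρ t (toℕ i′)
    βi≢c : β i ≢ c
    βi≢c βi≡c with () ← trans (sym Dij≡true) (from (zeros⇔ i) βi≡c)
    separating : ∃[ b ] bit (toℕ {suc L} b) (β i) ≢ bit (toℕ b) c
    separating = bits-differ (suc L) (blockIndex<2^[1+L] ρ t (toℕ<n i)) c<2^[1+L] βi≢c
    b : Fin (suc L)
    b = proj₁ separating
    bitClass⊆ones : ∀ i′ → bit (toℕ b) (β i′) ≡ bit (toℕ b) (β i) → D n K i′ j ≡ true
    bitClass⊆ones i′ same-bit = ¬-not λ Di′j≡false →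
      proj₂ separating (trans (sym same-bit) (cong (bit (toℕ b)) (to (zeros⇔ i′) Di′j≡false)))

  D-factorization : HasBoolFactorization (D n K) (2 * (K * (suc L * 2)))
  D-factorization = cover⇒factorization (D n K) BitClass?
    (Fin*↠× (↠-id _) (Fin*↠× (↠-id _) (Fin*↠× (↠-id _) (↠-id _)))) D-covered

D-rank-bound : ∀ m k .{{_ : NonZero k}} →
  ∃[ r ] r ≤ 4 * k * suc ⌈log₂ suc m ⌉ × HasBoolFactorization (D (suc m) k) r
D-rank-bound m k with k + k ≤? suc m
... | yes k+k≤n =
  _ , ≤-reflexive (reorder k L) , D-factorization {L = L} k+k≤n (n≤2^⌈log₂n⌉ (suc m))
  where
  L : ℕ
  L = ⌈log₂ suc m ⌉
  reorder : ∀ k L → 2 * (k * (suc L * 2)) ≡ 4 * k * suc L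
  reorder = solve-∀
... | no  k+k≰n = suc m , ≤-trans (<⇒≤ (≰⇒> k+k≰n)) (k+k≤4k[1+L] k ⌈log₂ suc m ⌉) ,
                  HasBoolFactorization-byRows (D (suc m) k)
  where
  k+k≤4k[1+L] : ∀ k L → k + k ≤ 4 * k * suc L
  k+k≤4k[1+L] k L = subst (k + k ≤_) (expand k L) (m≤m+n (k + k) (2 * k + 4 * k * L))
    where
    expand : ∀ k L → k + k + (2 * k + 4 * k * L) ≡ 4 * k * suc L
    expand = solve-∀

4k[1+L]≤8kL : ∀ k L → 1 ≤ L → 4 * k * suc L ≤ 8 * k * L
4k[1+L]≤8kL k (suc L) _ =
  subst₂ _≤_ (sym (lhs k L)) (sym (rhs k L))
    (+-monoʳ-≤ (8 * k) (*-monoˡ-≤ (k * L) (m≤m+n 4 4)))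
  where
  lhs : ∀ k L → 4 * k * suc (suc L) ≡ 8 * k + 4 * (k * L)
  lhs = solve-∀
  rhs : ∀ k L → 8 * k * suc L ≡ 8 * k + 8 * (k * L)
  rhs = solve-∀

mainTheorem5 : Σ ℕ λ C → (1 ≤ C) × (∀ (n k : ℕ) → 1 ≤ k → k < n →
    Σ ℕ λ r → (r ≤ C * k * ⌈log₂ n ⌉) × HasBoolFactorization (D n k) r)
mainTheorem5 = 8 , s≤s z≤n , rank-bound
  where
  rank-bound : ∀ n k → 1 ≤ k → k < n →
    Σ ℕ λ r → (r ≤ 8 * k * ⌈log₂ n ⌉) × HasBoolFactorization (D n k) r
  rank-bound (suc m) k@(suc _) _ k<n with D-rank-bound m k
  ... | r , r≤4k[1+L] , factorization = r , ≤-trans r≤4k[1+L] (4k[1+L]≤8kL k L 1≤L) , factorization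
    where
    L : ℕ
    L = ⌈log₂ suc m ⌉
    1≤L : 1 ≤ L
    1≤L = ⌈log₂⌉-mono-≤ (≤-trans (s≤s (s≤s z≤n)) k<n)
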